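{- Let $n \ge 0$, and let $b_1,\dots,b_{n-1}$ and $d_1,\dots,d_n$ be elements of a commutative ring. Let $M_{b_1 \dots b_{n-1}}^{d_1 \dots d_n}$ be the $n\times n$ matrix with entries \[ M_{ij} = \begin{cases} b_i & \text{if } i<j,\\ b_j & \text{if } j<i,\\ d_i & \text{if } i=j. \end{cases} \] For $0 \le k \le n$, let $D_k = \det\left(M_{b_1 \dots b_{k-1}}^{d_1 \dots d_k}\right)$ (the $k\times k$ weighted threshold graph matrix built from $b_1,\dots,b_{k-1}$ and $d_1,\dots,d_k$), where the determinant of the $0\times 0$ matrix is defined to be $1$. Then \[ D_k = \begin{cases} 1 & \text{if } k=0,\\ d_1 & \text{if } k=1,\\ (d_k + d_{k-1} - 2b_{k-1})\, D_{k-1} - (b_{k-1}-d_{k-1})^2\, D_{k-2} & \text{if } k\ge 2. \end{cases} \]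
   Context: The matrix $M_{b_1 \dots b_{n-1}}^{d_1 \dots d_n}$ is called a weighted threshold graph matrix. -}

module Defs where

open import Level using (Level)
open import Algebra.Bundles using (CommutativeRing)
open import Data.Nat using (ℕ; zero; suc)
open import Data.Nat.Properties using (<-cmp)
open import Data.Fin using (Fin; zero; suc; toℕ; punchIn)
open import Relation.Binary.Definitions using (tri<; tri≈; tri>)

module _ {c ℓ : Level} (R : CommutativeRing c ℓ) where
  open CommutativeRing R hiding (zero)

  ∑ : (n : ℕ) → (Fin n → Carrier) → Carrier
  ∑ zero    f = 0#
  ∑ (suc n) f = f zero + ∑ n (λ j → f (suc j))

  sgn : {n : ℕ} → Fin n → Carrier
  sgn zero    = 1#
  sgn (suc j) = - sgn j

  det : (n : ℕ) → (Fin n → Fin n → Carrier) → Carrier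
  det zero    M = 1#
  det (suc n) M =
    ∑ (suc n) (λ j → sgn j * (M zero j * det n (λ r s → M (suc r) (punchIn j s))))

  -- Sequences are 1-based: b i, d i for i ≥ 1 (value at index 0 is unused).
  -- The row with 0-based index i has 1-based index suc (toℕ i).
  wtgMatrix : (k : ℕ) → (b d : ℕ → Carrier) → Fin k → Fin k → Carrier
  wtgMatrix k b d i j with <-cmp (toℕ i) (toℕ j)
  ... | tri< _ _ _ = b (suc (toℕ i))
  ... | tri≈ _ _ _ = d (suc (toℕ i))
  ... | tri> _ _ _ = b (suc (toℕ j))

  D : (b d : ℕ → Carrier) → ℕ → Carrier
  D b d k = det k (wtgMatrix k b d)

module Submission where

-- The determinant `det` of Defs is the cofactor expansion along the FIRST
-- row, while the recurrence is about the LAST two rows; so we prove two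
-- general facts about `det`, each by induction on the size (a minor keeps the
-- last rows of the matrix, with one column punched out):
--
--  * det-perturbedLastRow: if the last row of M is its second-to-last row
--    plus a vector v supported on the last two columns, then
--      det M + v_{n-1} · det(M without last row, column n-1)
--            = v_n · det(M without last row and column);
--  * det-corner: adding δ to the bottom-right entry adds δ times the leading
--    principal minor to the determinant.
--
-- For W_{k+2} the last two rows differ by (0,…,0, b_{k+1}-d_{k+1}, d_{k+2}-b_{k+1}),
-- deleting the last row and column gives W_{k+1}, and deleting the last row
-- and column k+1 gives W_{k+1} with its corner raised by b_{k+1}-d_{k+1}.
-- The two lemmas thus give D_{k+2} + β(D_{k+1} + β D_k) = γ D_{k+1}, and the
-- stated recurrence is this identity solved for D_{k+2}.

open import Defs
open import Level using (Level)
open import Algebra.Bundles using (CommutativeRing)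
open import Data.Nat using (ℕ; zero; suc; _≤_; _<_)
open import Data.Nat.Properties using (<-cmp; <-irrefl)
open import Data.Product using (Σ; _×_; _,_)
open import Data.Fin using (Fin; zero; suc; toℕ; punchIn; inject₁; fromℕ)
open import Data.Fin.Properties using (toℕ-inject₁; toℕ-fromℕ; toℕ<n)
open import Data.Empty using (⊥-elim)
open import Relation.Binary.Definitions using (tri<; tri≈; tri>)
import Relation.Binary.PropositionalEquality as ≡
open ≡ using (_≡_)

punchIn-inject₁ : ∀ {n} (j : Fin (suc n)) (s : Fin n) →
                  punchIn (inject₁ j) (inject₁ s) ≡ inject₁ (punchIn j s)
punchIn-inject₁ zero    s       = ≡.refl
punchIn-inject₁ (suc j) zero    = ≡.refl
punchIn-inject₁ (suc j) (suc s) = ≡.cong suc (punchIn-inject₁ j s)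

punchIn-inject₁-last : ∀ {n} (j : Fin (suc n)) → punchIn (inject₁ j) (fromℕ n) ≡ fromℕ (suc n)
punchIn-inject₁-last zero            = ≡.refl
punchIn-inject₁-last {suc n} (suc j) = ≡.cong suc (punchIn-inject₁-last j)

punchIn-last : ∀ {n} (s : Fin n) → punchIn (fromℕ n) s ≡ inject₁ s
punchIn-last zero    = ≡.refl
punchIn-last (suc s) = ≡.cong suc (punchIn-last s)

punchIn-SL-inject₁ : ∀ {n} (s : Fin n) →
                     punchIn (inject₁ (fromℕ n)) (inject₁ s) ≡ inject₁ (inject₁ s)
punchIn-SL-inject₁ {n} s = ≡.trans (punchIn-inject₁ (fromℕ n) s) (≡.cong inject₁ (punchIn-last s))

punchIn-inner-SL : ∀ {n} (j : Fin (suc n)) →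
                   punchIn (inject₁ (inject₁ j)) (inject₁ (fromℕ n)) ≡ inject₁ (fromℕ (suc n))
punchIn-inner-SL {n} j = ≡.trans (punchIn-inject₁ (inject₁ j) (fromℕ n)) (≡.cong inject₁ (punchIn-inject₁-last j))

punchIn-before-SL : ∀ {n} (j s : Fin (suc n)) →
  punchIn (inject₁ (inject₁ j)) (punchIn (inject₁ (fromℕ n)) s)
    ≡ punchIn (inject₁ (fromℕ (suc n))) (punchIn (inject₁ j) s)
punchIn-before-SL zero            s       = ≡.refl
punchIn-before-SL {suc n} (suc j) zero    = ≡.refl
punchIn-before-SL {suc n} (suc j) (suc s) = ≡.cong suc (punchIn-before-SL j s)

punchIn-below-SL : ∀ {n} (j : Fin (suc (suc (suc n)))) (s : Fin n) →
  Σ (Fin (suc n)) λ t → punchIn j (inject₁ (inject₁ s)) ≡ inject₁ (inject₁ t)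
punchIn-below-SL zero            s       = suc s , ≡.refl
punchIn-below-SL (suc j)         zero    = zero , ≡.refl
punchIn-below-SL {suc n} (suc j) (suc s) with punchIn-below-SL j s
... | t , eq = suc t , ≡.cong suc eq

module WithRing {r ℓ : Level} (R : CommutativeRing r ℓ) where
  open CommutativeRing R hiding (zero)
  open import Algebra.Properties.CommutativeMonoid.Sum +-commutativeMonoid
    using (sum; sum-init-last; sum-cong-≋; ∑-distrib-+)
  open import Algebra.Properties.Semiring.Sum semiring using (*-distribˡ-sum)
  open import Algebra.Properties.Group +-group using (∙-cancelʳ; x≈z//y; //-rightDividesˡ)
  open import Algebra.Properties.AbelianGroup +-abelianGroup using (⁻¹-∙-comm)
  open import Algebra.Properties.Ring ring using (-‿distribˡ-*; -1*x≈-x; -‿involutive; [y-z]x≈yx-zx)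
  open import Algebra.Solver.Ring.NaturalCoefficients.Default commutativeSemiring
    using (solve; _:=_; _:+_; _:*_)
  open import Relation.Binary.Reasoning.Setoid setoid

  Matrix : ℕ → Set r
  Matrix n = Fin n → Fin n → Carrier

  ∑≡sum : ∀ n (f : Fin n → Carrier) → ∑ R n f ≡ sum f
  ∑≡sum zero    f = ≡.refl
  ∑≡sum (suc n) f = ≡.cong (f zero +_) (∑≡sum n (λ j → f (suc j)))

  sum-linear : ∀ {n} (f g : Fin n → Carrier) x →
               sum (λ j → f j + x * g j) ≈ sum f + x * sum g
  sum-linear f g x = trans (∑-distrib-+ f (λ j → x * g j))
                           (+-congˡ (sym (*-distribˡ-sum x g)))

  minor : ∀ {n} → Matrix (suc n) → Fin (suc n) → Matrix n
  minor M j r s = M (suc r) (punchIn j s)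

  cofactor : ∀ {n} → Matrix (suc n) → Fin (suc n) → Carrier
  cofactor {n} M j = sgn R j * (M zero j * det R n (minor M j))

  det-expansion : ∀ {n} (M : Matrix (suc n)) → det R (suc n) M ≈ sum (cofactor M)
  det-expansion {n} M = reflexive (∑≡sum (suc n) (cofactor M))

  det-expansion-last : ∀ {n} (M : Matrix (suc n)) →
    det R (suc n) M ≈ sum (λ j → cofactor M (inject₁ j)) + cofactor M (fromℕ n)
  det-expansion-last M = trans (det-expansion M) (sum-init-last (cofactor M))

  det-cong : ∀ n {M N : Matrix n} → (∀ r s → M r s ≈ N r s) → det R n M ≈ det R n N
  det-cong zero    eq = refl
  det-cong (suc n) {M} {N} eq = ∑-cong (suc n) {cofactor M} {cofactor N} λ j →
    *-congˡ (*-cong (eq zero j) (det-cong n λ r s → eq (suc r) (punchIn j s)))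
    where
    ∑-cong : ∀ n {f g : Fin n → Carrier} → (∀ j → f j ≈ g j) → ∑ R n f ≈ ∑ R n g
    ∑-cong zero    eq = refl
    ∑-cong (suc n) eq = +-cong (eq zero) (∑-cong n (λ j → eq (suc j)))

  det-1 : (M : Matrix 1) → det R 1 M ≈ M zero zero
  det-1 M = trans (+-identityʳ _) (trans (*-identityˡ _) (*-identityʳ _))

  det-2 : (M : Matrix 2) → det R 2 M + M zero (suc zero) * M (suc zero) zero
                           ≈ M zero zero * M (suc zero) (suc zero)
  det-2 M = begin
    det R 2 M + b * c                                ≈⟨ +-congʳ (+-cong (*-congˡ (*-congˡ (det-1 (minor M zero))))
                                                           (trans (+-identityʳ _) (*-congˡ (*-congˡ (det-1 (minor M (suc zero))))))) ⟩
    (1# * (a * d) + - 1# * (b * c)) + b * c          ≈⟨ +-congʳ (+-cong (*-identityˡ _) (-1*x≈-x _)) ⟩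
    (a * d - b * c) + b * c                          ≈⟨ //-rightDividesˡ (b * c) (a * d) ⟩
    a * d                                            ∎
    where
    a = M zero zero
    b = M zero (suc zero)
    c = M (suc zero) zero
    d = M (suc zero) (suc zero)

  sgn-inject₁ : ∀ {n} (j : Fin n) → sgn R (inject₁ j) ≡ sgn R j
  sgn-inject₁ zero    = ≡.refl
  sgn-inject₁ (suc j) = ≡.cong -_ (sgn-inject₁ j)

  dropLast : ∀ {n} → Matrix (suc n) → Matrix n
  dropLast M r s = M (inject₁ r) (inject₁ s)

  dropLastRowSL : ∀ {n} → Matrix (suc (suc n)) → Matrix (suc n)
  dropLastRowSL {n} M r s = M (inject₁ r) (punchIn (inject₁ (fromℕ n)) s)

  dropLast-minor : ∀ {n} (M : Matrix (suc (suc n))) j r s →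
                   dropLast (minor M (inject₁ j)) r s ≡ minor (dropLast M) j r s
  dropLast-minor M j r s = ≡.cong (M (suc (inject₁ r))) (punchIn-inject₁ j s)

  dropLastRowSL-minor : ∀ {n} (M : Matrix (suc (suc (suc n)))) (j : Fin (suc n)) r s →
    dropLastRowSL (minor M (inject₁ (inject₁ j))) r s ≡ minor (dropLastRowSL M) (inject₁ j) r s
  dropLastRowSL-minor M j r s = ≡.cong (M (suc (inject₁ r))) (punchIn-before-SL j s)

  dropLastRowSL-minor-last : ∀ {n} (M : Matrix (suc (suc (suc n)))) r s →
    dropLast (minor M (fromℕ (suc (suc n)))) r s ≡ minor (dropLastRowSL M) (fromℕ (suc n)) r s
  dropLastRowSL-minor-last {n} M r s = ≡.cong (M (suc (inject₁ r))) (≡.trans (punchIn-last (inject₁ s))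
    (≡.sym (≡.trans (≡.cong (punchIn (inject₁ (fromℕ (suc n)))) (punchIn-last s)) (punchIn-SL-inject₁ s))))

  cofactor-scale : ∀ σ a x z γ → x ≈ γ * z → σ * (a * x) ≈ γ * (σ * (a * z))
  cofactor-scale σ a x z γ eq = begin
    σ * (a * x)       ≈⟨ *-congˡ (*-congˡ eq) ⟩
    σ * (a * (γ * z)) ≈⟨ solve 4 (λ σ a z γ → σ :* (a :* (γ :* z)) := γ :* (σ :* (a :* z))) refl σ a z γ ⟩
    γ * (σ * (a * z)) ∎

  cofactor-combine : ∀ σ a x y z β γ → x + β * y ≈ γ * z →
                     σ * (a * x) + β * (σ * (a * y)) ≈ γ * (σ * (a * z))
  cofactor-combine σ a x y z β γ eq = begin
    σ * (a * x) + β * (σ * (a * y)) ≈⟨ solve 5 (λ σ a x y β → σ :* (a :* x) :+ β :* (σ :* (a :* y))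
                                                          := σ :* (a :* (x :+ β :* y))) refl σ a x y β ⟩
    σ * (a * (x + β * y))           ≈⟨ cofactor-scale σ a _ z γ eq ⟩
    γ * (σ * (a * z))               ∎

  cofactor-cancel : ∀ σ a x z β → x ≈ β * z → (- σ) * (a * x) + β * (σ * (a * z)) ≈ 0#
  cofactor-cancel σ a x z β eq = begin
    (- σ) * (a * x) + β * (σ * (a * z)) ≈⟨ +-cong (sym (-‿distribˡ-* σ _)) (sym (cofactor-scale σ a x z β eq)) ⟩
    - (σ * (a * x)) + σ * (a * x)       ≈⟨ -‿inverseˡ _ ⟩
    0#                                  ∎

  split-difference : ∀ x y → x ≈ y + (x - y)
  split-difference x y = sym (trans (+-comm y (x - y)) (//-rightDividesˡ y x))

  combine-groups : ∀ S x y SA a SD e β γ → S + β * SA ≈ γ * SD → x ≈ γ * e → y + β * a ≈ 0# →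
                   ((S + x) + y) + β * (SA + a) ≈ γ * (SD + e)
  combine-groups S x y SA a SD e β γ inner-eq x-eq y-eq = begin
    ((S + x) + y) + β * (SA + a)     ≈⟨ solve 6 (λ S x y SA a β → ((S :+ x) :+ y) :+ β :* (SA :+ a)
                                           := ((S :+ β :* SA) :+ x) :+ (y :+ β :* a)) refl S x y SA a β ⟩
    ((S + β * SA) + x) + (y + β * a) ≈⟨ +-cong (+-cong inner-eq x-eq) y-eq ⟩
    (γ * SD + γ * e) + 0#            ≈⟨ +-identityʳ _ ⟩
    γ * SD + γ * e                   ≈⟨ distribˡ γ SD e ⟨
    γ * (SD + e)                     ∎

  det-perturbedLastRow : ∀ n (M : Matrix (suc (suc n))) (v : Fin (suc (suc n)) → Carrier) →
    (∀ s → M (fromℕ (suc n)) s ≈ M (inject₁ (fromℕ n)) s + v s) →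
    (∀ s → v (inject₁ (inject₁ s)) ≈ 0#) →
    det R (suc (suc n)) M + v (inject₁ (fromℕ n)) * det R (suc n) (dropLastRowSL M)
      ≈ v (fromℕ (suc n)) * det R (suc n) (dropLast M)
  -- 2×2: with rows (a b) and (a+v₀ b+v₁), det + v₀ b = v₁ a, checked up to the term a b
  det-perturbedLastRow zero M v rows _ = ∙-cancelʳ (a * b) _ _ (begin
    (det R 2 M + v₀ * det R 1 (dropLastRowSL M)) + a * b  ≈⟨ +-congʳ (+-congˡ (*-congˡ (det-1 (dropLastRowSL M)))) ⟩
    (det R 2 M + v₀ * b) + a * b                          ≈⟨ solve 4 (λ D a b v₀ → (D :+ v₀ :* b) :+ a :* b
                                                                       := D :+ b :* (a :+ v₀)) refl (det R 2 M) a b v₀ ⟩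
    det R 2 M + b * (a + v₀)                              ≈⟨ +-congˡ (*-congˡ (sym (rows zero))) ⟩
    det R 2 M + b * M (suc zero) zero                     ≈⟨ det-2 M ⟩
    a * M (suc zero) (suc zero)                           ≈⟨ *-congˡ (rows (suc zero)) ⟩
    a * (b + v₁)                                          ≈⟨ solve 3 (λ a b v₁ → a :* (b :+ v₁) := v₁ :* a :+ a :* b) refl a b v₁ ⟩
    v₁ * a + a * b                                        ≈⟨ +-congʳ (*-congˡ (sym (det-1 (dropLast M)))) ⟩
    v₁ * det R 1 (dropLast M) + a * b                     ∎)
    where
    a = M zero zero
    b = M zero (suc zero)
    v₀ = v zero
    v₁ = v (suc zero)
  det-perturbedLastRow (suc n) M v rows support = begin
    det R _ M + v SL * det R _ A
      ≈⟨ +-cong (trans (det-expansion-last M) (+-congʳ (sum-init-last (λ j → T (inject₁ j)))))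
                (*-congˡ (det-expansion-last A)) ⟩
    ((sum inner + T SL) + T L) + v SL * (sum innerA + TA L′)
      ≈⟨ combine-groups _ _ _ _ _ (sum innerD) (TD L′) (v SL) (v L) inner-sum SL-term L-term ⟩
    v L * (sum innerD + TD L′)
      ≈⟨ *-congˡ (det-expansion-last (dropLast M)) ⟨
    v L * det R _ (dropLast M)
      ∎
    where
    L SL : Fin (suc (suc (suc n)))
    L  = fromℕ (suc (suc n))
    SL = inject₁ (fromℕ (suc n))
    L′ SL′ : Fin (suc (suc n))
    L′  = fromℕ (suc n)
    SL′ = inject₁ (fromℕ n)
    A = dropLastRowSL M
    T  = cofactor M
    TA = cofactor A
    TD = cofactor (dropLast M)
    inner innerA innerD : Fin (suc n) → Carrier
    inner j  = T (inject₁ (inject₁ j))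
    innerA j = TA (inject₁ j)
    innerD j = TD (inject₁ j)

    v-at : ∀ {p q} → p ≡ q → v p ≈ v q
    v-at eq = reflexive (≡.cong v eq)

    ih : ∀ j → det R _ (minor M j) + v (punchIn j SL′) * det R _ (dropLastRowSL (minor M j))
                 ≈ v (punchIn j L′) * det R _ (dropLast (minor M j))
    ih j = det-perturbedLastRow n (minor M j) (λ s → v (punchIn j s)) (λ s → rows (punchIn j s)) support′
      where
      support′ : ∀ s → v (punchIn j (inject₁ (inject₁ s))) ≈ 0#
      support′ s with punchIn-below-SL j s
      ... | t , eq = trans (v-at eq) (support t)

    -- in the minors at SL and at L the restricted v vanishes at SL′,
    -- so only the leading principal minor survives
    ih-drop : ∀ j {j′} → v (punchIn j SL′) ≈ 0# → v (punchIn j L′) ≈ v j′ →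
              det R _ (minor M j) ≈ v j′ * det R _ (dropLast (minor M j))
    ih-drop j zero-at at = trans (sym (trans (+-congˡ (trans (*-congʳ zero-at) (zeroˡ _))) (+-identityʳ _)))
                                 (trans (ih j) (*-congʳ at))

    inner-term : ∀ j → inner j + v SL * innerA j ≈ v L * innerD j
    inner-term j = begin
      σ * (a * X) + v SL * innerA j      ≈⟨ +-congˡ (*-congˡ (*-cong (reflexive (≡.sym (sgn-inject₁ (inject₁ j))))
                                               (*-congʳ (reflexive (≡.cong (M zero) (punchIn-SL-inject₁ j)))))) ⟩
      σ * (a * X) + v SL * (σ * (a * Y)) ≈⟨ cofactor-combine σ a X Y Z (v SL) (v L) minor-eq ⟩
      v L * (σ * (a * Z))                ≈⟨ *-congˡ (*-congʳ (reflexive (sgn-inject₁ (inject₁ j)))) ⟩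
      v L * innerD j                     ∎
      where
      jj = inject₁ (inject₁ j)
      σ = sgn R jj
      a = M zero jj
      X = det R _ (minor M jj)
      Y = det R _ (minor A (inject₁ j))
      Z = det R _ (minor (dropLast M) (inject₁ j))
      minor-eq : X + v SL * Y ≈ v L * Z
      minor-eq = begin
        X + v SL * Y                                       ≈⟨ +-congˡ (*-cong (v-at (≡.sym (punchIn-inner-SL j)))
                                                                  (det-cong _ (λ r s → reflexive (≡.sym (dropLastRowSL-minor M j r s))))) ⟩
        X + v (punchIn jj SL′) * det R _ (dropLastRowSL (minor M jj)) ≈⟨ ih jj ⟩
        v (punchIn jj L′) * det R _ (dropLast (minor M jj)) ≈⟨ *-cong (v-at (punchIn-inject₁-last (inject₁ j)))
                                                                  (det-cong _ (λ r s → reflexive (dropLast-minor M (inject₁ j) r s))) ⟩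
        v L * Z                                            ∎

    inner-sum : sum inner + v SL * sum innerA ≈ v L * sum innerD
    inner-sum = begin
      sum inner + v SL * sum innerA            ≈⟨ sum-linear inner innerA (v SL) ⟨
      sum (λ j → inner j + v SL * innerA j)    ≈⟨ sum-cong-≋ inner-term ⟩
      sum (λ j → v L * innerD j)               ≈⟨ *-distribˡ-sum (v L) innerD ⟨
      v L * sum innerD                         ∎

    -- column SL contributes only to the leading principal minor
    SL-term : T SL ≈ v L * TD L′
    SL-term = trans (*-congʳ (reflexive (sgn-inject₁ L′)))
      (cofactor-scale _ _ _ _ (v L)
        (trans (ih-drop SL (trans (v-at (punchIn-SL-inject₁ (fromℕ n))) (support (fromℕ n)))
                           (v-at (punchIn-inject₁-last (fromℕ (suc n)))))
               (*-congˡ (det-cong _ (λ r s → reflexive (dropLast-minor M L′ r s))))))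

    -- column L cancels against the last cofactor term of the SL-deleted minor
    L-term : T L + v SL * TA L′ ≈ 0#
    L-term = trans (+-congˡ (*-congˡ (*-congˡ (*-congʳ (reflexive (≡.cong (M zero) (punchIn-inject₁-last (fromℕ (suc n)))))))))
      (cofactor-cancel (sgn R L′) (M zero L) _ _ (v SL)
        (trans (ih-drop L (trans (v-at (punchIn-last SL′)) (support (fromℕ n))) (v-at (punchIn-last L′)))
               (*-congˡ (det-cong _ (λ r s → reflexive (dropLastRowSL-minor-last M r s))))))

  det-corner : ∀ n (M N : Matrix (suc n)) δ →
    (∀ r s → N r (inject₁ s) ≈ M r (inject₁ s)) →
    (∀ r → N (inject₁ r) (fromℕ n) ≈ M (inject₁ r) (fromℕ n)) →
    N (fromℕ n) (fromℕ n) ≈ M (fromℕ n) (fromℕ n) + δ →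
    det R (suc n) N ≈ det R (suc n) M + δ * det R n (dropLast M)
  det-corner zero M N δ _ _ corner = begin
    det R 1 N          ≈⟨ det-1 N ⟩
    N zero zero        ≈⟨ corner ⟩
    M zero zero + δ    ≈⟨ +-cong (det-1 M) (*-identityʳ δ) ⟨
    det R 1 M + δ * 1# ∎
  det-corner (suc n) M N δ cols lastCol corner = begin
    det R _ N                                           ≈⟨ det-expansion-last N ⟩
    sum (λ j → TN (inject₁ j)) + TN L                   ≈⟨ +-cong (sum-cong-≋ inner-term) last-term ⟩
    sum (λ j → TM (inject₁ j) + δ * TD j) + TM L        ≈⟨ +-congʳ (sum-linear (λ j → TM (inject₁ j)) TD δ) ⟩
    (sum (λ j → TM (inject₁ j)) + δ * sum TD) + TM L    ≈⟨ solve 3 (λ x y z → (x :+ y) :+ z := (x :+ z) :+ y) refl _ _ _ ⟩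
    (sum (λ j → TM (inject₁ j)) + TM L) + δ * sum TD    ≈⟨ +-cong (det-expansion-last M) (*-congˡ (det-expansion (dropLast M))) ⟨
    det R _ M + δ * det R _ (dropLast M)                ∎
    where
    L = fromℕ (suc n)
    TN = cofactor N
    TM = cofactor M
    TD = cofactor (dropLast M)

    ih : ∀ j → det R _ (minor N (inject₁ j))
                 ≈ det R _ (minor M (inject₁ j)) + δ * det R _ (dropLast (minor M (inject₁ j)))
    ih j = det-corner n (minor M (inject₁ j)) (minor N (inject₁ j)) δ
      (λ r s → ≡.subst (λ t → N (suc r) t ≈ M (suc r) t) (≡.sym (punchIn-inject₁ j s)) (cols (suc r) (punchIn j s)))
      (λ r → ≡.subst (λ t → N (suc (inject₁ r)) t ≈ M (suc (inject₁ r)) t) (≡.sym (punchIn-inject₁-last j)) (lastCol (suc r)))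
      (≡.subst (λ t → N L′ t ≈ M L′ t + δ) (≡.sym (punchIn-inject₁-last j)) corner)
      where L′ = fromℕ (suc n)

    inner-term : ∀ j → TN (inject₁ j) ≈ TM (inject₁ j) + δ * TD j
    inner-term j = begin
      σ * (N zero (inject₁ j) * det R _ (minor N (inject₁ j))) ≈⟨ *-congˡ (*-cong (cols zero j) (ih j)) ⟩
      σ * (a * (X + δ * Z))                                    ≈⟨ solve 5 (λ σ a X Z δ → σ :* (a :* (X :+ δ :* Z))
                                                                     := σ :* (a :* X) :+ δ :* (σ :* (a :* Z))) refl σ a X Z δ ⟩
      σ * (a * X) + δ * (σ * (a * Z))                          ≈⟨ +-congˡ (*-congˡ (*-cong (reflexive (sgn-inject₁ j))
                                                                     (*-congˡ (det-cong _ (λ r s → reflexive (dropLast-minor M j r s)))))) ⟩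
      TM (inject₁ j) + δ * TD j                                ∎
      where
      σ = sgn R (inject₁ j)
      a = M zero (inject₁ j)
      X = det R _ (minor M (inject₁ j))
      Z = det R _ (dropLast (minor M (inject₁ j)))

    -- the minor at the last column does not see the corner
    last-term : TN L ≈ TM L
    last-term = *-congˡ (*-cong (lastCol zero) (det-cong _ λ r s →
      ≡.subst (λ t → N (suc r) t ≈ M (suc r) t) (≡.sym (punchIn-last s)) (cols (suc r) s)))

  weight : (b d : ℕ → Carrier) → ℕ → ℕ → Carrier
  weight b d i j with <-cmp i j
  ... | tri< _ _ _ = b (suc i)
  ... | tri≈ _ _ _ = d (suc i)
  ... | tri> _ _ _ = b (suc j)

  wtgMatrix-weight : ∀ k b d (i j : Fin k) → wtgMatrix R k b d i j ≡ weight b d (toℕ i) (toℕ j)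
  wtgMatrix-weight k b d i j with <-cmp (toℕ i) (toℕ j)
  ... | tri< _ _ _ = ≡.refl
  ... | tri≈ _ _ _ = ≡.refl
  ... | tri> _ _ _ = ≡.refl

  weight-< : ∀ b d {i j} → i < j → weight b d i j ≡ b (suc i)
  weight-< b d {i} {j} i<j with <-cmp i j
  ... | tri< _ _ _   = ≡.refl
  ... | tri≈ i≮j _ _ = ⊥-elim (i≮j i<j)
  ... | tri> i≮j _ _ = ⊥-elim (i≮j i<j)

  weight-> : ∀ b d {i j} → j < i → weight b d i j ≡ b (suc j)
  weight-> b d {i} {j} j<i with <-cmp i j
  ... | tri< _ _ j≮i = ⊥-elim (j≮i j<i)
  ... | tri≈ _ _ j≮i = ⊥-elim (j≮i j<i)
  ... | tri> _ _ _   = ≡.refl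

  weight-≡ : ∀ b d i → weight b d i i ≡ d (suc i)
  weight-≡ b d i with <-cmp i i
  ... | tri< i<i _ _ = ⊥-elim (<-irrefl ≡.refl i<i)
  ... | tri≈ _ _ _   = ≡.refl
  ... | tri> _ _ i<i = ⊥-elim (<-irrefl ≡.refl i<i)

  module Threshold (b d : ℕ → Carrier) where

    W : (k : ℕ) → Matrix k
    W k = wtgMatrix R k b d

    W-inject₁ : ∀ {k} (i j : Fin k) → W (suc k) (inject₁ i) (inject₁ j) ≡ W k i j
    W-inject₁ {k} i j = ≡.trans (wtgMatrix-weight (suc k) b d (inject₁ i) (inject₁ j))
      (≡.trans (≡.cong₂ (weight b d) (toℕ-inject₁ i) (toℕ-inject₁ j)) (≡.sym (wtgMatrix-weight k b d i j)))

    W-lastRow : ∀ {k} (j : Fin k) → W (suc k) (fromℕ k) (inject₁ j) ≡ b (suc (toℕ j))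
    W-lastRow {k} j = ≡.trans (wtgMatrix-weight (suc k) b d (fromℕ k) (inject₁ j))
      (≡.trans (≡.cong₂ (weight b d) (toℕ-fromℕ k) (toℕ-inject₁ j)) (weight-> b d (toℕ<n j)))

    W-lastCol : ∀ {k} (i : Fin k) → W (suc k) (inject₁ i) (fromℕ k) ≡ b (suc (toℕ i))
    W-lastCol {k} i = ≡.trans (wtgMatrix-weight (suc k) b d (inject₁ i) (fromℕ k))
      (≡.trans (≡.cong₂ (weight b d) (toℕ-inject₁ i) (toℕ-fromℕ k)) (weight-< b d (toℕ<n i)))

    W-corner : ∀ k → W (suc k) (fromℕ k) (fromℕ k) ≡ d (suc k)
    W-corner k = ≡.trans (wtgMatrix-weight (suc k) b d (fromℕ k) (fromℕ k))
      (≡.trans (≡.cong₂ (weight b d) (toℕ-fromℕ k) (toℕ-fromℕ k)) (weight-≡ b d k))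

    b-at-last : ∀ k → b (suc (toℕ (fromℕ k))) ≡ b (suc k)
    b-at-last k = ≡.cong (λ i → b (suc i)) (toℕ-fromℕ k)

    recurrence : ∀ m → let β = b (suc m) - d (suc m) ; γ = d (suc (suc m)) - b (suc m) in
      D R b d (suc (suc m)) + β * (D R b d (suc m) + β * D R b d m) ≈ γ * D R b d (suc m)
    recurrence m = begin
      det R _ X + β * (D R b d (suc m) + β * D R b d m) ≈⟨ +-congˡ (*-cong v-SL dropLastRowSL-det) ⟨
      det R _ X + v SL * det R _ (dropLastRowSL X)      ≈⟨ det-perturbedLastRow m X v rows support ⟩
      v L * det R _ (dropLast X)                        ≈⟨ *-cong v-L (det-cong _ λ r s → reflexive (W-inject₁ {suc m} r s)) ⟩
      γ * D R b d (suc m)                               ∎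
      where
      β = b (suc m) - d (suc m)
      γ = d (suc (suc m)) - b (suc m)
      X = W (suc (suc m))
      L = fromℕ (suc m)
      SL = inject₁ (fromℕ m)

      v : Fin (suc (suc m)) → Carrier
      v s = X L s - X SL s

      rows : ∀ s → X L s ≈ X SL s + v s
      rows s = split-difference (X L s) (X SL s)

      support : ∀ t → v (inject₁ (inject₁ t)) ≈ 0#
      support t = trans (+-congʳ (reflexive (≡.trans (W-lastRow (inject₁ t))
                          (≡.trans (≡.cong (λ i → b (suc i)) (toℕ-inject₁ t))
                                   (≡.sym (≡.trans (W-inject₁ (fromℕ m) (inject₁ t)) (W-lastRow t)))))))
                        (-‿inverseʳ _)

      X-SL-L : X SL L ≡ b (suc m)
      X-SL-L = ≡.trans (W-lastCol (fromℕ m)) (b-at-last m)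

      v-SL : v SL ≈ β
      v-SL = +-cong (reflexive (≡.trans (W-lastRow (fromℕ m)) (b-at-last m)))
                    (-‿cong (reflexive (≡.trans (W-inject₁ (fromℕ m) (fromℕ m)) (W-corner m))))

      v-L : v L ≈ γ
      v-L = +-cong (reflexive (W-corner (suc m))) (-‿cong (reflexive X-SL-L))

      -- deleting column m of X gives W (m+1) with its corner raised by β
      dropLastRowSL-det : det R _ (dropLastRowSL X) ≈ D R b d (suc m) + β * D R b d m
      dropLastRowSL-det = trans
        (det-corner m (W (suc m)) (dropLastRowSL X) β
          (λ r s → reflexive (≡.trans (≡.cong (X (inject₁ r)) (punchIn-SL-inject₁ s)) (W-inject₁ r (inject₁ s))))
          (λ r → reflexive (≡.trans (≡.cong (X (inject₁ (inject₁ r))) (punchIn-inject₁-last (fromℕ m)))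
                   (≡.trans (W-lastCol (inject₁ r))
                   (≡.trans (≡.cong (λ i → b (suc i)) (toℕ-inject₁ r)) (≡.sym (W-lastCol r))))))
          (trans (reflexive (≡.trans (≡.cong (X SL) (punchIn-inject₁-last (fromℕ m))) X-SL-L))
                 (trans (split-difference (b (suc m)) (d (suc m)))
                        (+-congʳ (reflexive (≡.sym (W-corner m)))))))
        (+-congˡ (*-congˡ (det-cong _ λ r s → reflexive (W-inject₁ {m} r s))))

  solve-for-D : ∀ x D₁ D₀ b₁ d₁ d₂ → x + (b₁ - d₁) * (D₁ + (b₁ - d₁) * D₀) ≈ (d₂ - b₁) * D₁ →
                x ≈ (d₂ + d₁ - (b₁ + b₁)) * D₁ - ((b₁ - d₁) * (b₁ - d₁)) * D₀
  solve-for-D x D₁ D₀ b₁ d₁ d₂ eq = begin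
    x                                      ≈⟨ x≈z//y x _ _ eq ⟩
    γ * D₁ - β * (D₁ + β * D₀)             ≈⟨ +-congˡ (-‿cong (trans (distribˡ β D₁ _) (+-congˡ (sym (*-assoc β β D₀))))) ⟩
    γ * D₁ - (β * D₁ + (β * β) * D₀)       ≈⟨ +-congˡ (⁻¹-∙-comm (β * D₁) _) ⟨
    γ * D₁ + (- (β * D₁) - (β * β) * D₀)   ≈⟨ +-assoc _ _ _ ⟨
    (γ * D₁ - β * D₁) - (β * β) * D₀       ≈⟨ +-congʳ ([y-z]x≈yx-zx D₁ γ β) ⟨
    (γ - β) * D₁ - (β * β) * D₀            ≈⟨ +-congʳ (*-congʳ coefficient) ⟩
    (d₂ + d₁ - (b₁ + b₁)) * D₁ - (β * β) * D₀ ∎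
    where
    β = b₁ - d₁
    γ = d₂ - b₁
    coefficient : γ - β ≈ d₂ + d₁ - (b₁ + b₁)
    coefficient = begin
      (d₂ - b₁) - (b₁ - d₁)         ≈⟨ +-congˡ (⁻¹-∙-comm b₁ (- d₁)) ⟨
      (d₂ - b₁) + (- b₁ + - - d₁)   ≈⟨ +-congˡ (+-congˡ (-‿involutive d₁)) ⟩
      (d₂ - b₁) + (- b₁ + d₁)       ≈⟨ solve 3 (λ d₂ nb d₁ → (d₂ :+ nb) :+ (nb :+ d₁) := (d₂ :+ d₁) :+ (nb :+ nb))
                                          refl d₂ (- b₁) d₁ ⟩
      (d₂ + d₁) + (- b₁ + - b₁)     ≈⟨ +-congˡ (⁻¹-∙-comm b₁ b₁) ⟩
      d₂ + d₁ - (b₁ + b₁)           ∎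

theorem1 : {c ℓ : Level} (R : CommutativeRing c ℓ) → let open CommutativeRing R in
    (n : ℕ) (b d : ℕ → Carrier) →
    (D R b d 0 ≈ 1#)
    × ((1 ≤ n) → D R b d 1 ≈ d 1)
    × ((m : ℕ) → suc (suc m) ≤ n →
    D R b d (suc (suc m))
    ≈ (d (suc (suc m)) + d (suc m) - (b (suc m) + b (suc m))) * D R b d (suc m)
    - ((b (suc m) - d (suc m)) * (b (suc m) - d (suc m))) * D R b d m)
theorem1 R n b d =
    refl
  , (λ _ → det-1 (wtgMatrix R 1 b d))
  , (λ m _ → solve-for-D _ _ _ _ _ _ (Threshold.recurrence b d m))
  where
  open CommutativeRing R using (refl)
  open WithRing R
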